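{- Let $P$ be an odd prime and $\alpha,b',c'$ positive integers. Put $A=\alpha b'c'$ and assume $m:=4A-P>0$. Then there exists $d'\in\mathbb{N}$ with \[ (4\alpha d'b'-1)(4\alpha d'c'-1)=4\alpha P\,d'^2+1 \] if and only if $b'c'=A/\alpha$ and $b'+c'\equiv0\pmod m$. In that case $d'=\frac{b'+c'}{m}\in\mathbb{N}$. -}

module Defs where

open import Data.Nat using (ℕ; _*_)
open import Data.Integer as ℤ using (ℤ; +_)
open import Relation.Binary.PropositionalEquality using (_≡_)

Eqn : (P α b c d : ℕ) → Set
Eqn P α b c d =
  ((+ (4 * α * d * b)) ℤ.- ℤ.1ℤ) ℤ.* ((+ (4 * α * d * c)) ℤ.- ℤ.1ℤ)
    ≡ (+ (4 * α * P * (d * d))) ℤ.+ ℤ.1ℤ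

{-# OPTIONS --safe #-}
module Submission where

-- Expanding, (4αdb − 1)(4αdc − 1) − (4αPd² + 1) = 4αd · (d(4αbc − P) − (b + c)).
-- For d > 0 the equation therefore says exactly d · m = b + c with m = 4αbc − P,
-- so a positive solution exists iff m ∣ b + c (the quotient is positive since
-- b + c > 0), and it is then d = (b + c)/m.  The condition bc = αbc/α always holds.

open import Defs
open import Data.Nat using (ℕ; _*_; _+_; _∸_; _<_; _≤_; NonZero; >-nonZero; >-nonZero⁻¹)
open import Data.Nat.DivMod using (_/_; m*n/n≡m)
open import Data.Nat.Divisibility using (_∣_; divides; quotient; quotient≢0; m∣n⇒n≡quotient*m)
open import Data.Nat.Primality using (Prime)
open import Data.Product using (_×_; _,_; ∃-syntax)
open import Function.Bundles using (_⇔_; mk⇔; Equivalence)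
open import Relation.Binary.PropositionalEquality using (_≡_; _≢_; sym; trans; cong; cong₂; module ≡-Reasoning)

import Data.Nat.Properties as ℕ
open import Data.Integer as ℤ using (ℤ; +_; 0ℤ; 1ℤ)
import Data.Integer.Properties as ℤ
open import Data.Integer.Tactic.RingSolver using (solve-∀)
import Function.Properties.Equivalence as ⇔

m*n*o/m≡n*o : ∀ m n o .{{_ : NonZero m}} → m * n * o / m ≡ n * o
m*n*o/m≡n*o m n o = begin
  m * n * o / m   ≡⟨ cong (_/ m) (ℕ.*-assoc m n o) ⟩
  m * (n * o) / m ≡⟨ cong (_/ m) (ℕ.*-comm m (n * o)) ⟩
  n * o * m / m   ≡⟨ m*n/n≡m (n * o) m ⟩
  n * o           ∎
  where open ≡-Reasoning

pos-*³ : ∀ x y z → + (x * y * z) ≡ + x ℤ.* + y ℤ.* + z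
pos-*³ x y z = trans (ℤ.pos-* (x * y) z) (cong (ℤ._* + z) (ℤ.pos-* x y))

pos-∸ : ∀ {m n} → n ≤ m → + (m ∸ n) ≡ + m ℤ.- + n
pos-∸ {m} {n} n≤m = trans (sym (ℤ.≤-⊖ n≤m)) (sym (ℤ.[+m]-[+n]≡m⊖n m n))

i-j≡k*[l-m]⇒[i≡j⇔l≡m] : ∀ {i j l m} k .{{_ : ℤ.NonZero k}} →
  i ℤ.- j ≡ k ℤ.* (l ℤ.- m) → (i ≡ j) ⇔ (l ≡ m)
i-j≡k*[l-m]⇒[i≡j⇔l≡m] {i} {j} {l} {m} k gap = mk⇔ to from
  where
  open ≡-Reasoning
  to : i ≡ j → l ≡ m
  to i≡j = ℤ.i-j≡0⇒i≡j l m (ℤ.*-cancelˡ-≡ k (l ℤ.- m) 0ℤ (begin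
    k ℤ.* (l ℤ.- m) ≡⟨ sym gap ⟩
    i ℤ.- j         ≡⟨ ℤ.i≡j⇒i-j≡0 i≡j ⟩
    0ℤ              ≡⟨ sym (ℤ.*-zeroʳ k) ⟩
    k ℤ.* 0ℤ        ∎))
  from : l ≡ m → i ≡ j
  from l≡m = ℤ.i-j≡0⇒i≡j i j (begin
    i ℤ.- j         ≡⟨ gap ⟩
    k ℤ.* (l ℤ.- m) ≡⟨ cong (k ℤ.*_) (ℤ.i≡j⇒i-j≡0 l≡m) ⟩
    k ℤ.* 0ℤ        ≡⟨ ℤ.*-zeroʳ k ⟩
    0ℤ              ∎)

Eqn-gap-identity : ∀ (a p b c d : ℤ) →
  (a ℤ.* d ℤ.* b ℤ.- 1ℤ) ℤ.* (a ℤ.* d ℤ.* c ℤ.- 1ℤ) ℤ.- (a ℤ.* p ℤ.* (d ℤ.* d) ℤ.+ 1ℤ)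
    ≡ a ℤ.* d ℤ.* (d ℤ.* (a ℤ.* b ℤ.* c ℤ.- p) ℤ.- (b ℤ.+ c))
Eqn-gap-identity = solve-∀

module _ (P α b c : ℕ) where

  m : ℕ
  m = 4 * (α * b * c) ∸ P

  Eqn-gap : ∀ d → P ≤ 4 * (α * b * c) →
    (+ (4 * α * d * b) ℤ.- 1ℤ) ℤ.* (+ (4 * α * d * c) ℤ.- 1ℤ) ℤ.- (+ (4 * α * P * (d * d)) ℤ.+ 1ℤ)
      ≡ + (4 * α * d) ℤ.* (+ (d * m) ℤ.- + (b + c))
  Eqn-gap d P≤4A = begin
    (+ (4 * α * d * b) ℤ.- 1ℤ) ℤ.* (+ (4 * α * d * c) ℤ.- 1ℤ) ℤ.- (+ (4 * α * P * (d * d)) ℤ.+ 1ℤ)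
      ≡⟨ cong₂ (λ x y → x ℤ.- (y ℤ.+ 1ℤ))
           (cong₂ (λ x y → (x ℤ.- 1ℤ) ℤ.* (y ℤ.- 1ℤ)) (pos-*³ (4 * α) d b) (pos-*³ (4 * α) d c))
           (trans (pos-*³ (4 * α) P (d * d)) (cong (a ℤ.* p ℤ.*_) (ℤ.pos-* d d))) ⟩
    (a ℤ.* δ ℤ.* β ℤ.- 1ℤ) ℤ.* (a ℤ.* δ ℤ.* γ ℤ.- 1ℤ) ℤ.- (a ℤ.* p ℤ.* (δ ℤ.* δ) ℤ.+ 1ℤ)
      ≡⟨ Eqn-gap-identity a p β γ δ ⟩
    a ℤ.* δ ℤ.* (δ ℤ.* (a ℤ.* β ℤ.* γ ℤ.- p) ℤ.- (β ℤ.+ γ))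
      ≡⟨ cong₂ (λ x y → x ℤ.* (y ℤ.- (β ℤ.+ γ))) (sym (ℤ.pos-* (4 * α) d)) (sym +dm) ⟩
    + (4 * α * d) ℤ.* (+ (d * m) ℤ.- (β ℤ.+ γ))
      ≡⟨ cong (λ x → + (4 * α * d) ℤ.* (+ (d * m) ℤ.- x)) (sym (ℤ.pos-+ b c)) ⟩
    + (4 * α * d) ℤ.* (+ (d * m) ℤ.- + (b + c)) ∎
    where
    open ≡-Reasoning
    a p β γ δ : ℤ
    a = + (4 * α)
    p = + P
    β = + b
    γ = + c
    δ = + d
    reassoc : 4 * (α * b * c) ≡ 4 * α * b * c
    reassoc = trans (sym (ℕ.*-assoc 4 (α * b) c)) (cong (_* c) (sym (ℕ.*-assoc 4 α b)))
    +dm : + (d * m) ≡ δ ℤ.* (a ℤ.* β ℤ.* γ ℤ.- p)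
    +dm = begin
      + (d * m)                         ≡⟨ ℤ.pos-* d m ⟩
      δ ℤ.* + m                         ≡⟨ cong (δ ℤ.*_) (pos-∸ P≤4A) ⟩
      δ ℤ.* (+ (4 * (α * b * c)) ℤ.- p) ≡⟨ cong (λ x → δ ℤ.* (+ x ℤ.- p)) reassoc ⟩
      δ ℤ.* (+ (4 * α * b * c) ℤ.- p)   ≡⟨ cong (λ x → δ ℤ.* (x ℤ.- p)) (pos-*³ (4 * α) b c) ⟩
      δ ℤ.* (a ℤ.* β ℤ.* γ ℤ.- p)       ∎

  Eqn⇔ : ∀ d .{{_ : NonZero α}} → 0 < d → P ≤ 4 * (α * b * c) →
    Eqn P α b c d ⇔ (d * m ≡ b + c)
  Eqn⇔ d 0<d P≤4A = ⇔.trans (i-j≡k*[l-m]⇒[i≡j⇔l≡m] (+ (4 * α * d)) {{4αd≢0}} (Eqn-gap d P≤4A))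
                            (mk⇔ ℤ.+-injective (cong (λ n → + n)))
    where
    4αd≢0 : NonZero (4 * α * d)
    4αd≢0 = ℕ.m*n≢0 (4 * α) d {{ℕ.m*n≢0 4 α}} {{>-nonZero 0<d}}

theoremD1 : (P α b c : ℕ) → .{{_ : NonZero α}} → Prime P → P ≢ 2 → 0 < b → 0 < c →
    P < 4 * (α * b * c) →
    ((∃[ d ] (0 < d × Eqn P α b c d))
    ⇔ ((b * c ≡ (α * b * c) / α) × ((4 * (α * b * c) ∸ P) ∣ (b + c))))
    × (∀ d → 0 < d → Eqn P α b c d → d * (4 * (α * b * c) ∸ P) ≡ b + c)
theoremD1 P α b c _ _ 0<b _ P<4A = mk⇔ solution⇒ ⇒solution , solution⇒formula
  where
  P≤4A : P ≤ 4 * (α * b * c)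
  P≤4A = ℕ.<⇒≤ P<4A

  solution⇒formula : ∀ d → 0 < d → Eqn P α b c d → d * m P α b c ≡ b + c
  solution⇒formula d 0<d = Equivalence.to (Eqn⇔ P α b c d 0<d P≤4A)

  solution⇒ : ∃[ d ] (0 < d × Eqn P α b c d) → (b * c ≡ α * b * c / α) × (m P α b c ∣ b + c)
  solution⇒ (d , 0<d , e) = sym (m*n*o/m≡n*o α b c) , divides d (sym (solution⇒formula d 0<d e))

  ⇒solution : (b * c ≡ α * b * c / α) × (m P α b c ∣ b + c) → ∃[ d ] (0 < d × Eqn P α b c d)
  ⇒solution (_ , m∣b+c) =
    d , 0<d , Equivalence.from (Eqn⇔ P α b c d 0<d P≤4A) (sym (m∣n⇒n≡quotient*m m∣b+c))
    where
    d : ℕ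
    d = quotient m∣b+c
    0<d : 0 < d
    0<d = >-nonZero⁻¹ d {{quotient≢0 m∣b+c {{>-nonZero (ℕ.<-≤-trans 0<b (ℕ.m≤m+n b c))}}}}
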